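{- Let $T$ be an order tree and $G$ a $T$-graph. The following are equivalent: (i) $G$ is uniform, i.e. for every limit $t\in T$ there is a finite $S_t\subset\mathring{\lceil t\rceil}$ such that every $t'>t$ has all its neighbours $s$ with $s<t$ inside $S_t$; (ii) for every limit $t\in T$, the vertex set $\lfloor t\rfloor\setminus\{t\}$ has finite neighbourhood in $G$; (iii) for every $t\in T$, the vertex set $\lfloor t\rfloor\setminus\{t\}$ has finite neighbourhood in $G$.
   Context: An order tree is a poset $(T,\le)$ with a unique minimal element in which every $\lceil t\rceil=\{t'\le t\}$ is well-ordered; $\mathring{\lceil t\rceil}=\lceil t\rceil\setminus\{t\}$ and $\lfloor t\rfloor=\{t'\in T: t\le t'\}$. $t'$ is a successor of $t$ if $t<t'$ with no point strictly between; a point is a limit if it is not a successor of any point. A graph $G$ is a $T$-graph if $V(G)=T$, endvertices of every edge are comparable in $T$, and for each $t$ the set of neighbours of $t$ below $t$ is cofinal in $\mathring{\lceil t\rceil}$. -}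

module Defs where

open import Level using (0ℓ)
open import Data.Product using (Σ; ∃; ∃-syntax; _×_; _,_)
open import Data.Sum using (_⊎_)
open import Data.List using (List)
open import Data.List.Membership.Propositional using (_∈_)
open import Relation.Nullary using (¬_)
open import Relation.Binary.PropositionalEquality using (_≡_; _≢_)
open import Relation.Binary.Structures using (IsPartialOrder)
open import Induction.WellFounded using (Acc)

record OrderTree : Set₁ where
  field
    Carrier        : Set
    _≤_            : Carrier → Carrier → Set
    isPartialOrder : IsPartialOrder _≡_ _≤_

  _<_ : Carrier → Carrier → Set
  a < b = (a ≤ b) × (a ≢ b)

  Minimal : Carrier → Set
  Minimal m = ∀ t → t ≤ m → t ≡ m

  field
    root         : Carrier
    root-minimal : Minimal root
    root-unique  : ∀ m → Minimal m → m ≡ root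
    down-total   : ∀ t a b → a ≤ t → b ≤ t → (a ≤ b) ⊎ (b ≤ a)
    -- ⌈t⌉ is well-founded (for the strict order restricted to ⌈t⌉;
    -- elements below a ∈ ⌈t⌉ all lie in ⌈t⌉, so this is Acc for _<_)
    down-wf      : ∀ t a → a ≤ t → Acc _<_ a

  IsSuccessorOf : Carrier → Carrier → Set
  IsSuccessorOf t' t = (t < t') × (¬ (∃[ u ] ((t < u) × (u < t'))))

  IsLimit : Carrier → Set
  IsLimit t = ∀ s → ¬ IsSuccessorOf t s

record TGraph (T : OrderTree) : Set₁ where
  open OrderTree T
  field
    Adj        : Carrier → Carrier → Set
    Adj-sym    : ∀ {a b} → Adj a b → Adj b a
    Adj-irrefl : ∀ {a} → ¬ Adj a a
    Adj-comparable : ∀ {a b} → Adj a b → (a ≤ b) ⊎ (b ≤ a)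
    cofinal    : ∀ t s → s < t → ∃[ u ] (Adj u t × (s ≤ u) × (u < t))

module _ {T : OrderTree} (G : TGraph T) where
  open OrderTree T
  open TGraph G

  Uniform : Set
  Uniform = ∀ t → IsLimit t →
    Σ (List Carrier) λ S →
      (∀ s → s ∈ S → s < t) ×
      (∀ t' → t < t' → ∀ s → Adj t' s → s < t → s ∈ S)

  InNeighbourhood : (Carrier → Set) → Carrier → Set
  InNeighbourhood X v = (¬ X v) × (∃[ u ] (X u × Adj u v))

  FiniteNeighbourhood : (Carrier → Set) → Set
  FiniteNeighbourhood X =
    Σ (List Carrier) λ xs → ∀ v → InNeighbourhood X v → v ∈ xs

  -- the vertex set ⌊t⌋ ∖ {t} = {t' : t < t'}
  UpStrict : Carrier → Carrier → Set
  UpStrict t t' = t < t'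

{-# OPTIONS --safe #-}
module Submission where

-- The neighbourhood of the up-set ⌊t⌋ ∖ {t} lies in ⌈t⌉, because every edge joins comparable
-- points and ⌈u⌉ is a chain for each u > t. Its part strictly below t consists exactly of the
-- points of ⌈t⌉ ∖ {t} adjacent to something above t, i.e. what a uniformity witness S_t must
-- contain; this gives (i) ⇔ (ii) pointwise. For a successor t of s, nothing lies strictly between
-- s and t, so the neighbourhood of the up-set of t is contained in that of s together with t;
-- well-founded induction along ⌈t⌉ therefore reduces (iii) to the limit case (ii).

open import Defs
open import Level using (0ℓ)
open import Axiom.ExcludedMiddle using (ExcludedMiddle)
open import Data.Product using (_×_; Σ; ∃; _,_; proj₁; proj₂)
open import Data.Empty using (⊥-elim)
open import Data.Sum using (_⊎_; inj₁; inj₂)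
open import Data.List using (List; _∷_; filter)
open import Data.List.Membership.Propositional using (_∈_)
open import Data.List.Membership.Propositional.Properties using (∈-filter⁺; ∈-filter⁻)
open import Data.List.Relation.Unary.Any using (here; there)
open import Relation.Nullary using (¬_; yes; no)
open import Relation.Binary.PropositionalEquality using (_≡_; refl)
open import Relation.Binary.Bundles using (Poset)
open import Relation.Unary using (Decidable)
open import Induction.WellFounded using (Acc; acc)
open import Function.Bundles using (_⇔_; mk⇔; Equivalence)

module _ (em : ExcludedMiddle 0ℓ) {T : OrderTree} (G : TGraph T) where
  open OrderTree T
  open TGraph G

  private
    poset : Poset 0ℓ 0ℓ 0ℓ
    poset = record { isPartialOrder = isPartialOrder }

  open Poset poset using () renaming (refl to ≤-refl; trans to ≤-trans)
  open import Relation.Binary.Properties.Poset poset using (<-trans; <⇒≱)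

  UniformAt : Carrier → Set
  UniformAt t =
    Σ (List Carrier) λ S →
      (∀ s → s ∈ S → s < t) ×
      (∀ t' → t < t' → ∀ s → Adj t' s → s < t → s ∈ S)

  ≤⇒<⊎≡ : ∀ {a b} → a ≤ b → a < b ⊎ a ≡ b
  ≤⇒<⊎≡ {a} {b} a≤b with em {a ≡ b}
  ... | yes a≡b = inj₂ a≡b
  ... | no a≢b = inj₁ (a≤b , a≢b)

  ≤∧≮⇒≥ : ∀ {a b} → a ≤ b → ¬ a < b → b ≤ a
  ≤∧≮⇒≥ a≤b a≮b with ≤⇒<⊎≡ a≤b
  ... | inj₁ a<b = ⊥-elim (a≮b a<b)
  ... | inj₂ refl = ≤-refl

  Adj-above∧≮⇒≤ : ∀ {t u v} → t < u → Adj u v → ¬ t < v → v ≤ t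
  Adj-above∧≮⇒≤ {t} {u} {v} (t≤u , _) uv t≮v with Adj-comparable uv
  ... | inj₁ u≤v = ≤∧≮⇒≥ (≤-trans t≤u u≤v) t≮v
  ... | inj₂ v≤u with down-total u v t v≤u t≤u
  ...   | inj₁ v≤t = v≤t
  ...   | inj₂ t≤v = ≤∧≮⇒≥ t≤v t≮v

  neighbourhood-↑⊆⌈⌉ : ∀ {t v} → InNeighbourhood G (UpStrict G t) v → v ≤ t
  neighbourhood-↑⊆⌈⌉ (t≮v , u , t<u , uv) = Adj-above∧≮⇒≤ t<u uv t≮v

  below⇒∈neighbourhood-↑ : ∀ {t t' s} → t < t' → Adj t' s → s < t →
                           InNeighbourhood G (UpStrict G t) s
  below⇒∈neighbourhood-↑ t<t' t's (s≤t , _) = (λ t<s → <⇒≱ t<s s≤t) , _ , t<t' , t's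

  finiteNeighbourhood-↑ : ∀ {t} (xs : List Carrier) →
    (∀ v → v < t → InNeighbourhood G (UpStrict G t) v → v ∈ xs) →
    FiniteNeighbourhood G (UpStrict G t)
  finiteNeighbourhood-↑ {t} xs below = t ∷ xs , cover
    where
    cover : ∀ v → InNeighbourhood G (UpStrict G t) v → v ∈ t ∷ xs
    cover v v∈N with ≤⇒<⊎≡ (neighbourhood-↑⊆⌈⌉ v∈N)
    ... | inj₁ v<t = there (below v v<t v∈N)
    ... | inj₂ refl = here refl

  uniformAt⇔finiteNeighbourhood-↑ : ∀ t → UniformAt t ⇔ FiniteNeighbourhood G (UpStrict G t)
  uniformAt⇔finiteNeighbourhood-↑ t = mk⇔ to from
    where
    to : UniformAt t → FiniteNeighbourhood G (UpStrict G t)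
    to (S , _ , S-complete) = finiteNeighbourhood-↑ S λ
      { v v<t (_ , u , t<u , uv) → S-complete u t<u v uv v<t }

    from : FiniteNeighbourhood G (UpStrict G t) → UniformAt t
    from (xs , xs-covers) =
      filter <t? xs ,
      (λ s s∈S → proj₂ (∈-filter⁻ <t? {xs = xs} s∈S)) ,
      (λ t' t<t' s t's s<t →
        ∈-filter⁺ <t? (xs-covers s (below⇒∈neighbourhood-↑ t<t' t's s<t)) s<t)
      where
      <t? : Decidable (_< t)
      <t? _ = em

  finiteNeighbourhood-↑-successor : ∀ {s t} → IsSuccessorOf t s →
    FiniteNeighbourhood G (UpStrict G s) → FiniteNeighbourhood G (UpStrict G t)
  finiteNeighbourhood-↑-successor {s} {t} (s<t , nothing-between) (xs , xs-covers) =
    finiteNeighbourhood-↑ xs λ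
      { v v<t (_ , u , t<u , uv) →
          xs-covers v ((λ s<v → nothing-between (v , s<v , v<t)) , u , <-trans s<t t<u , uv) }

  finiteNeighbourhood-↑-from-limits :
    (∀ t → IsLimit t → FiniteNeighbourhood G (UpStrict G t)) →
    ∀ t → FiniteNeighbourhood G (UpStrict G t)
  finiteNeighbourhood-↑-from-limits atLimits t = go t (down-wf t t ≤-refl)
    where
    go : ∀ t → Acc _<_ t → FiniteNeighbourhood G (UpStrict G t)
    go t (acc rec) with em {∃ λ s → IsSuccessorOf t s}
    ... | yes (s , t-succ-s) =
      finiteNeighbourhood-↑-successor t-succ-s (go s (rec (proj₁ t-succ-s)))
    ... | no notSuccessor = atLimits t λ s t-succ-s → notSuccessor (s , t-succ-s)

lemma4p3 : ExcludedMiddle 0ℓ → (T : OrderTree) → (G : TGraph T) →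
    let open OrderTree T in
    (Uniform G ⇔ (∀ t → IsLimit t → FiniteNeighbourhood G (UpStrict G t)))
    × ((∀ t → IsLimit t → FiniteNeighbourhood G (UpStrict G t))
    ⇔ (∀ t → FiniteNeighbourhood G (UpStrict G t)))
lemma4p3 em T G =
  mk⇔ (λ uniform t lim → to (pointwise t) (uniform t lim))
      (λ finite t lim → from (pointwise t) (finite t lim)) ,
  mk⇔ (finiteNeighbourhood-↑-from-limits em G) (λ finite t _ → finite t)
  where
  open Equivalence
  pointwise = uniformAt⇔finiteNeighbourhood-↑ em G
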